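{- For $k\ge 1$ let $m_k$ be the number of primitive $k\times k$ Fishburn matrices (equivalently, the number of primitive interval orders of magnitude $k$). Then, as formal power series in $t$, \[ \sum_{k\ge 1} m_k t^k = \sum_{n\ge 0}t^{n+1} \prod_{i=0}^n \frac{2^{i+1}-1}{1+t(2^{i+1}-1)}. \]
   Context: A Fishburn matrix is an upper-triangular square matrix of nonnegative integers in which every row and every column contains a nonzero entry; it is primitive if all its entries are $0$ or $1$. (Interval orders, i.e. finite posets up to isomorphism with no induced subposet isomorphic to the disjoint union of two 2-element chains, are in bijection with Fishburn matrices, with magnitude = number of distinct strict down-sets corresponding to the dimension of the matrix, and primitive interval orders — those with no two distinct elements having the same strict down-set and the same strict up-set — corresponding to primitive Fishburn matrices.) -}

module Defs where

open import Data.Nat as ℕ using (ℕ; zero; suc; _∸_; _^_; _≤ᵇ_; _<ᵇ_)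
open import Data.Integer as ℤ using (ℤ; +_; -_; _-_)
open import Data.Bool using (Bool; true; false; if_then_else_)
open import Data.Bool.Properties using () renaming (_≟_ to _≟ᵇ_)
open import Data.Fin using (Fin; _<_)
open import Data.Fin.Properties using (all?; any?; _<?_)
open import Data.Vec using (Vec; []; _∷_; lookup)
open import Data.List using (List; []; _∷_; map; concatMap; filter; length; foldr; upTo)
open import Data.Product using (∃; _×_)
open import Relation.Binary.PropositionalEquality using (_≡_)
open import Relation.Nullary using (Dec; ¬_)
open import Relation.Nullary.Decidable using (_×-dec_; _→-dec_)

-- Primitive Fishburn matrices.
-- A primitive Fishburn matrix has all entries in {0,1}; we encode an
-- entry 1 as true and 0 as false.  A k×k 0/1 matrix is a Vec of k rows.

BMatrix : ℕ → Set
BMatrix k = Vec (Vec Bool k) k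

entry : ∀ {k} → BMatrix k → Fin k → Fin k → Bool
entry M i j = lookup (lookup M i) j

UpperTriangular : ∀ {k} → BMatrix k → Set
UpperTriangular {k} M = (i j : Fin k) → j < i → entry M i j ≡ false

RowsNonzero : ∀ {k} → BMatrix k → Set
RowsNonzero {k} M = (i : Fin k) → ∃ λ (j : Fin k) → entry M i j ≡ true

ColsNonzero : ∀ {k} → BMatrix k → Set
ColsNonzero {k} M = (j : Fin k) → ∃ λ (i : Fin k) → entry M i j ≡ true

PrimitiveFishburn : ∀ {k} → BMatrix k → Set
PrimitiveFishburn M = UpperTriangular M × RowsNonzero M × ColsNonzero M

primitiveFishburn? : ∀ {k} (M : BMatrix k) → Dec (PrimitiveFishburn M)
primitiveFishburn? M =
  all? (λ i → all? (λ j → (j <? i) →-dec (entry M i j ≟ᵇ false)))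
  ×-dec all? (λ i → any? (λ j → entry M i j ≟ᵇ true))
  ×-dec all? (λ j → any? (λ i → entry M i j ≟ᵇ true))

allVecs : ∀ {A : Set} → List A → (n : ℕ) → List (Vec A n)
allVecs xs zero = [] ∷ []
allVecs xs (suc n) = concatMap (λ v → map (λ x → x ∷ v) xs) (allVecs xs n)

allBMatrices : (k : ℕ) → List (BMatrix k)
allBMatrices k = allVecs (allVecs (true ∷ false ∷ []) k) k

numPrimFishburn : ℕ → ℕ
numPrimFishburn k = length (filter primitiveFishburn? (allBMatrices k))

FPS : Set
FPS = ℕ → ℤ

sumTo : ℕ → (ℕ → ℤ) → ℤ
sumTo zero f = + 0
sumTo (suc n) f = sumTo n f ℤ.+ f n

constS : ℤ → FPS
constS c zero = c
constS c (suc _) = + 0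

oneS : FPS
oneS = constS (+ 1)

onePlusT : ℤ → FPS
onePlusT c zero = + 1
onePlusT c (suc zero) = c
onePlusT c (suc (suc _)) = + 0

_*S_ : FPS → FPS → FPS
(a *S b) k = sumTo (suc k) (λ i → a i ℤ.* b (k ∸ i))

shiftS : ℕ → FPS → FPS
shiftS m a k = if k <ᵇ m then + 0 else a (k ∸ m)

-- Multiplicative inverse of a series with constant term 1:
-- b₀ = 1,  b_{n+1} = - Σ_{j=0}^{n} a_{j+1} b_{n-j}.
-- invUpTo a n agrees with the inverse on coefficients 0..n.
invUpTo : FPS → ℕ → FPS
invUpTo a zero = λ _ → + 1
invUpTo a (suc n) = λ i →
  if i ≤ᵇ n then invUpTo a n i
  else - sumTo (suc n) (λ j → a (suc j) ℤ.* invUpTo a n (n ∸ j))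

invS : FPS → FPS
invS a k = invUpTo a k k

prodS : List FPS → FPS
prodS = foldr _*S_ oneS

coefA : ℕ → ℤ
coefA i = + (2 ^ suc i) - + 1

factorS : ℕ → FPS
factorS i = constS (coefA i) *S invS (onePlusT (coefA i))

termS : ℕ → FPS
termS n = shiftS (suc n) (prodS (map factorS (upTo (suc n))))

-- The infinite sum is well defined since termS n has order ≥ n+1:
-- the coefficient of t^k only receives contributions from n < k ≤ k.
rhsS : FPS
rhsS k = sumTo (suc k) (λ n → termS n k)

lhsS : FPS
lhsS zero = + 0
lhsS (suc k) = + numPrimFishburn (suc k)

-- Inclusion–exclusion over the set S of columns forced to be empty makes the
-- rows independent: row i of a 0/1 upper-triangular matrix then ranges over
-- the nonzero vectors supported on the f columns j ≥ i outside S, and there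
-- are 2^f − 1 of them.  Hence m_k = Σ_S w(S) with w(s ∷ S) = ±(2^c − 1) w(S),
-- c the number of columns of s ∷ S outside the set.  Grouped by c, these sums
-- satisfy F(k+1, c+1) = a_c (F(k, c) − F(k, c+1)), a_c = 2^(c+1) − 1.  The
-- coefficient of t^k in t^c ∏_{i<c} a_i/(1 + a_i t) satisfies the same
-- recursion, because (1 + a_c t) ∏_{i≤c} = a_c ∏_{i<c}; summing over c gives
-- the right-hand side.

module Submission where

open import Defs
open import Data.Nat as ℕ using (ℕ; zero; suc; _≡ᵇ_; z≤n; s≤s)
import Data.Nat.Properties as ℕP
open import Data.Integer as ℤ using (ℤ; +_; -_; _-_; _+_; _*_; _^_)
import Data.Integer.Properties as ℤP
open import Data.Integer.Tactic.RingSolver using (solve-∀)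
open import Data.Bool using (Bool; true; false; if_then_else_; not; _∧_; _∨_; T)
open import Data.Bool.Properties using (T-≡) renaming (_≟_ to _≟ᵇ_)
open import Data.Unit using (tt)
open import Data.Sum using (inj₁; inj₂)
open import Data.Fin using (Fin; zero; suc)
open import Data.Fin.Properties using (all?; any?; _<?_)
open import Data.Vec using (Vec; []; _∷_; lookup)
open import Data.List using (List; []; _∷_; map; foldr; upTo; _++_; concatMap; filter; length)
import Data.List.Properties as LP
open import Function using (_∘_; Equivalence)
open import Relation.Nullary using (Dec; yes; no; does; contradiction)
open import Relation.Nullary.Decidable using (_×-dec_; _→-dec_)
open import Relation.Binary.PropositionalEquality
open import Algebra.Properties.CommutativeMonoid.Sum ℤP.*-1-commutativeMonoid
  using () renaming (sum to ∏; sum-cong-≗ to ∏-cong; ∑-distrib-+ to ∏-distrib-*; ∑-comm to ∏-comm; sum-replicate-zero to ∏-one)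
open import Algebra.Properties.CommutativeSemigroup ℤP.+-commutativeSemigroup
  using () renaming (interchange to +-interchange)
open import Algebra.Properties.CommutativeSemigroup ℤP.*-commutativeSemigroup
  using () renaming (interchange to *-interchange; x∙yz≈y∙xz to *-left-comm; xy∙z≈xz∙y to *-right-comm)

private variable A B : Set

sumTo-cong : ∀ n {f g : ℕ → ℤ} → (∀ i → i ℕ.< n → f i ≡ g i) → sumTo n f ≡ sumTo n g
sumTo-cong zero    f≡g = refl
sumTo-cong (suc n) f≡g =
  cong₂ _+_ (sumTo-cong n (λ i i<n → f≡g i (ℕP.m<n⇒m<1+n i<n))) (f≡g n ℕP.≤-refl)

sumTo-zero : ∀ n {f : ℕ → ℤ} → (∀ i → i ℕ.< n → f i ≡ + 0) → sumTo n f ≡ + 0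
sumTo-zero zero    f≡0 = refl
sumTo-zero (suc n) f≡0 =
  cong₂ _+_ (sumTo-zero n (λ i i<n → f≡0 i (ℕP.m<n⇒m<1+n i<n))) (f≡0 n ℕP.≤-refl)

sumTo-suc : ∀ n (f : ℕ → ℤ) → sumTo (suc n) f ≡ f 0 + sumTo n (f ∘ suc)
sumTo-suc zero    f = trans (ℤP.+-identityˡ (f 0)) (sym (ℤP.+-identityʳ (f 0)))
sumTo-suc (suc n) f =
  trans (cong (_+ f (suc n)) (sumTo-suc n f)) (ℤP.+-assoc (f 0) (sumTo n (f ∘ suc)) (f (suc n)))

sumTo-distrib-+ : ∀ n (f g : ℕ → ℤ) → sumTo n (λ i → f i + g i) ≡ sumTo n f + sumTo n g
sumTo-distrib-+ zero    f g = refl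
sumTo-distrib-+ (suc n) f g =
  trans (cong (_+ (f n + g n)) (sumTo-distrib-+ n f g))
        (+-interchange (sumTo n f) (sumTo n g) (f n) (g n))

*-distribˡ-sumTo : ∀ n c (f : ℕ → ℤ) → c * sumTo n f ≡ sumTo n (λ i → c * f i)
*-distribˡ-sumTo zero    c f = ℤP.*-zeroʳ c
*-distribˡ-sumTo (suc n) c f =
  trans (ℤP.*-distribˡ-+ c (sumTo n f) (f n)) (cong (_+ c * f n) (*-distribˡ-sumTo n c f))

infix 10 ∑-syntax ∏-syntax

∑ : List A → (A → ℤ) → ℤ
∑ []       f = + 0
∑ (x ∷ xs) f = f x + ∑ xs f

∑-syntax : List A → (A → ℤ) → ℤ
∑-syntax = ∑

syntax ∑-syntax xs (λ x → e) = ∑[ x ∈ xs ] e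

∏-syntax : ∀ n → (Fin n → ℤ) → ℤ
∏-syntax _ = ∏

syntax ∏-syntax n (λ i → e) = ∏[ i < n ] e

∑-cong : (xs : List A) {f g : A → ℤ} → f ≗ g → ∑ xs f ≡ ∑ xs g
∑-cong []       f≗g = refl
∑-cong (x ∷ xs) f≗g = cong₂ _+_ (f≗g x) (∑-cong xs f≗g)

∑-zero : (xs : List A) → ∑[ x ∈ xs ] (+ 0) ≡ + 0
∑-zero []       = refl
∑-zero (x ∷ xs) = trans (ℤP.+-identityˡ _) (∑-zero xs)

∑-++ : (xs ys : List A) (f : A → ℤ) → ∑ (xs ++ ys) f ≡ ∑ xs f + ∑ ys f
∑-++ []       ys f = sym (ℤP.+-identityˡ (∑ ys f))
∑-++ (x ∷ xs) ys f =
  trans (cong (_+_ (f x)) (∑-++ xs ys f)) (sym (ℤP.+-assoc (f x) (∑ xs f) (∑ ys f)))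

∑-distrib-+ : (xs : List A) (f g : A → ℤ) →
              ∑[ x ∈ xs ] (f x + g x) ≡ ∑ xs f + ∑ xs g
∑-distrib-+ []       f g = refl
∑-distrib-+ (x ∷ xs) f g =
  trans (cong (_+_ (f x + g x)) (∑-distrib-+ xs f g))
        (+-interchange (f x) (g x) (∑ xs f) (∑ xs g))

*-distribˡ-∑ : (c : ℤ) (xs : List A) (f : A → ℤ) → c * ∑ xs f ≡ ∑[ x ∈ xs ] (c * f x)
*-distribˡ-∑ c []       f = ℤP.*-zeroʳ c
*-distribˡ-∑ c (x ∷ xs) f =
  trans (ℤP.*-distribˡ-+ c (f x) (∑ xs f)) (cong (_+_ (c * f x)) (*-distribˡ-∑ c xs f))

*-distribʳ-∑ : (c : ℤ) (xs : List A) (f : A → ℤ) → ∑ xs f * c ≡ ∑[ x ∈ xs ] (f x * c)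
*-distribʳ-∑ c []       f = ℤP.*-zeroˡ c
*-distribʳ-∑ c (x ∷ xs) f =
  trans (ℤP.*-distribʳ-+ c (f x) (∑ xs f)) (cong (_+_ (f x * c)) (*-distribʳ-∑ c xs f))

∑-comm : (xs : List A) (ys : List B) (f : A → B → ℤ) →
         ∑[ x ∈ xs ] ∑[ y ∈ ys ] f x y ≡ ∑[ y ∈ ys ] ∑[ x ∈ xs ] f x y
∑-comm []       ys f = sym (∑-zero ys)
∑-comm (x ∷ xs) ys f =
  trans (cong (_+_ (∑ ys (f x))) (∑-comm xs ys f)) (sym (∑-distrib-+ ys (f x) _))

∑-map : (g : A → B) (xs : List A) (f : B → ℤ) →
        ∑ (map g xs) f ≡ ∑[ x ∈ xs ] f (g x)
∑-map g []       f = refl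
∑-map g (x ∷ xs) f = cong (_+_ (f (g x))) (∑-map g xs f)

∑-concatMap : (h : A → List B) (xs : List A) (f : B → ℤ) →
              ∑ (concatMap h xs) f ≡ ∑[ x ∈ xs ] ∑ (h x) f
∑-concatMap h []       f = refl
∑-concatMap h (x ∷ xs) f =
  trans (∑-++ (h x) (concatMap h xs) f) (cong (_+_ (∑ (h x) f)) (∑-concatMap h xs f))

∑-sumTo-comm : (xs : List A) (n : ℕ) (f : A → ℕ → ℤ) →
               ∑[ x ∈ xs ] sumTo n (f x) ≡ sumTo n (λ i → ∑[ x ∈ xs ] f x i)
∑-sumTo-comm []       n f = sym (sumTo-zero n (λ _ _ → refl))
∑-sumTo-comm (x ∷ xs) n f =
  trans (cong (_+_ (sumTo n (f x))) (∑-sumTo-comm xs n f)) (sym (sumTo-distrib-+ n (f x) _))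

∑-allVecs-suc : (xs : List A) (n : ℕ) (F : Vec A (suc n) → ℤ) →
                ∑ (allVecs xs (suc n)) F ≡ ∑[ v ∈ allVecs xs n ] ∑[ x ∈ xs ] F (x ∷ v)
∑-allVecs-suc xs n F =
  trans (∑-concatMap _ (allVecs xs n) F)
        (∑-cong (allVecs xs n) (λ v → ∑-map (_∷ v) xs F))

∑-allVecs-∏ : (xs : List A) (n : ℕ) (g : Fin n → A → ℤ) →
              ∑[ v ∈ allVecs xs n ] ∏[ i < n ] g i (lookup v i) ≡ ∏[ i < n ] ∑ xs (g i)
∑-allVecs-∏ xs zero    g = refl
∑-allVecs-∏ xs (suc n) g = begin
    ∑[ v ∈ allVecs xs (suc n) ] ∏[ i < suc n ] g i (lookup v i)
  ≡⟨ ∑-allVecs-suc xs n _ ⟩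
    ∑[ v ∈ allVecs xs n ] ∑[ x ∈ xs ] (g zero x * rest v)
  ≡⟨ ∑-cong (allVecs xs n) (λ v → sym (*-distribʳ-∑ (rest v) xs (g zero))) ⟩
    ∑[ v ∈ allVecs xs n ] (∑ xs (g zero) * rest v)
  ≡⟨ sym (*-distribˡ-∑ (∑ xs (g zero)) (allVecs xs n) rest) ⟩
    ∑ xs (g zero) * ∑ (allVecs xs n) rest
  ≡⟨ cong (_*_ (∑ xs (g zero))) (∑-allVecs-∏ xs n (g ∘ suc)) ⟩
    ∏[ i < suc n ] ∑ xs (g i) ∎
  where
  open ≡-Reasoning
  rest : Vec _ n → ℤ
  rest v = ∏[ i < n ] g (suc i) (lookup v i)

ι : Bool → ℤ
ι b = if b then + 1 else + 0

ι-∧ : ∀ a b → ι (a ∧ b) ≡ ι a * ι b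
ι-∧ true  b = sym (ℤP.*-identityˡ (ι b))
ι-∧ false b = refl

ι-all? : ∀ {n} {P : Fin n → Set} (P? : ∀ i → Dec (P i)) →
         ι (does (all? P?)) ≡ ∏[ i < n ] ι (does (P? i))
ι-all? {zero}  P? = refl
ι-all? {suc n} P? =
  trans (ι-∧ (does (P? zero)) _) (cong (_*_ (ι (does (P? zero)))) (ι-all? (P? ∘ suc)))

ι-any? : ∀ {n} {P : Fin n → Set} (P? : ∀ i → Dec (P i)) →
         ι (does (any? P?)) ≡ + 1 - ∏[ i < n ] ι (not (does (P? i)))
ι-any? {zero}  P? = refl
ι-any? {suc n} P? = head-case (does (P? zero))
  where
  rest : ℤ
  rest = ∏[ i < n ] ι (not (does (P? (suc i))))
  head-case : ∀ b → ι (b ∨ does (any? (P? ∘ suc))) ≡ + 1 - ι (not b) * rest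
  head-case true  = cong (λ z → + 1 - z) (sym (ℤP.*-zeroˡ rest))
  head-case false = trans (ι-any? (P? ∘ suc)) (cong (λ z → + 1 - z) (sym (ℤP.*-identityˡ rest)))

+length-filter : {P : A → Set} (P? : ∀ x → Dec (P x)) (xs : List A) →
                 + length (filter P? xs) ≡ ∑[ x ∈ xs ] ι (does (P? x))
+length-filter P? []       = refl
+length-filter P? (x ∷ xs) with does (P? x)
... | true  = cong (_+_ (+ 1)) (+length-filter P? xs)
... | false = trans (+length-filter P? xs) (sym (ℤP.+-identityˡ _))

-- Power series: the factors a/(1 + a t) and their products

scaleS : ℤ → FPS → FPS
scaleS a X m = a * X m

mulOnePlusT : ℤ → FPS → FPS
mulOnePlusT c X m = X m + c * shiftS 1 X m

shiftS-cong : ∀ c {X Y} → X ≗ Y → shiftS c X ≗ shiftS c Y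
shiftS-cong c X≗Y m = cong (if m ℕ.<ᵇ c then + 0 else_) (X≗Y (m ℕ.∸ c))

mulOnePlusT-cong : ∀ c {X Y} → X ≗ Y → mulOnePlusT c X ≗ mulOnePlusT c Y
mulOnePlusT-cong c X≗Y m = cong₂ (λ x y → x + c * y) (X≗Y m) (shiftS-cong 1 X≗Y m)

shiftS-suc : ∀ c X → shiftS (suc c) X ≗ shiftS 1 (shiftS c X)
shiftS-suc c X zero    = refl
shiftS-suc c X (suc m) = refl

shiftS-scaleS : ∀ c a X → shiftS c (scaleS a X) ≗ scaleS a (shiftS c X)
shiftS-scaleS c a X m with m ℕ.<ᵇ c
... | true  = sym (ℤP.*-zeroʳ a)
... | false = refl

shiftS-mulOnePlusT : ∀ c a X → shiftS c (mulOnePlusT a X) ≗ mulOnePlusT a (shiftS c X)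
shiftS-mulOnePlusT zero    a X m       = refl
shiftS-mulOnePlusT (suc c) a X zero    = sym (trans (ℤP.+-identityˡ _) (ℤP.*-zeroʳ a))
shiftS-mulOnePlusT (suc c) a X (suc m) =
  trans (shiftS-mulOnePlusT c a X m)
        (cong (λ y → shiftS c X m + a * y) (sym (shiftS-suc c X m)))

*S-congʳ : ∀ f {X Y} → X ≗ Y → (f *S X) ≗ (f *S Y)
*S-congʳ f X≗Y m = sumTo-cong (suc m) (λ i _ → cong (_*_ (f i)) (X≗Y (m ℕ.∸ i)))

*S-shiftS-1 : ∀ f X → (f *S shiftS 1 X) ≗ shiftS 1 (f *S X)
*S-shiftS-1 f X zero    = trans (ℤP.+-identityˡ _) (ℤP.*-zeroʳ (f 0))
*S-shiftS-1 f X (suc m) = begin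
    sumTo (suc m) (λ i → f i * shiftS 1 X (suc m ℕ.∸ i)) + f (suc m) * shiftS 1 X (m ℕ.∸ m)
  ≡⟨ cong₂ _+_ (sumTo-cong (suc m) earlier) (cong (λ d → f (suc m) * shiftS 1 X d) (ℕP.n∸n≡0 m)) ⟩
    (f *S X) m + f (suc m) * + 0
  ≡⟨ cong (_+_ ((f *S X) m)) (ℤP.*-zeroʳ (f (suc m))) ⟩
    (f *S X) m + + 0
  ≡⟨ ℤP.+-identityʳ _ ⟩
    (f *S X) m ∎
  where
  open ≡-Reasoning
  earlier : ∀ i → i ℕ.< suc m → f i * shiftS 1 X (suc m ℕ.∸ i) ≡ f i * X (m ℕ.∸ i)
  earlier i (s≤s i≤m) = cong (λ d → f i * shiftS 1 X d) (ℕP.+-∸-assoc 1 i≤m)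

*S-scaleS : ∀ f a X → (f *S scaleS a X) ≗ scaleS a (f *S X)
*S-scaleS f a X m =
  trans (sumTo-cong (suc m) (λ i _ → *-left-comm (f i) a (X (m ℕ.∸ i))))
        (sym (*-distribˡ-sumTo (suc m) a _))

*S-mulOnePlusT : ∀ c f X → (f *S mulOnePlusT c X) ≗ mulOnePlusT c (f *S X)
*S-mulOnePlusT c f X m = begin
    sumTo (suc m) (λ i → f i * (X (m ℕ.∸ i) + c * shiftS 1 X (m ℕ.∸ i)))
  ≡⟨ sumTo-cong (suc m) (λ i _ → distrib (f i) (X (m ℕ.∸ i)) (shiftS 1 X (m ℕ.∸ i))) ⟩
    sumTo (suc m) (λ i → f i * X (m ℕ.∸ i) + c * (f i * shiftS 1 X (m ℕ.∸ i)))
  ≡⟨ sumTo-distrib-+ (suc m) _ _ ⟩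
    (f *S X) m + sumTo (suc m) (λ i → c * (f i * shiftS 1 X (m ℕ.∸ i)))
  ≡⟨ cong (_+_ ((f *S X) m)) (sym (*-distribˡ-sumTo (suc m) c _)) ⟩
    (f *S X) m + c * (f *S shiftS 1 X) m
  ≡⟨ cong (λ y → (f *S X) m + c * y) (*S-shiftS-1 f X m) ⟩
    mulOnePlusT c (f *S X) m ∎
  where
  open ≡-Reasoning
  distrib : ∀ a x y → a * (x + c * y) ≡ a * x + c * (a * y)
  distrib a x y = trans (ℤP.*-distribˡ-+ a x (c * y)) (cong (_+_ (a * x)) (*-left-comm a c y))

foldr-*S-comm : (Φ : FPS → FPS) → (∀ {X Y} → X ≗ Y → Φ X ≗ Φ Y) → (∀ f X → (f *S Φ X) ≗ Φ (f *S X)) →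
                ∀ L Z → foldr _*S_ (Φ Z) L ≗ Φ (foldr _*S_ Z L)
foldr-*S-comm Φ Φ-cong Φ-comm []      Z m = refl
foldr-*S-comm Φ Φ-cong Φ-comm (f ∷ L) Z m =
  trans (*S-congʳ f (foldr-*S-comm Φ Φ-cong Φ-comm L Z) m) (Φ-comm f (foldr _*S_ Z L) m)

foldr-*S-cong : ∀ L {Z Z′} → Z ≗ Z′ → foldr _*S_ Z L ≗ foldr _*S_ Z′ L
foldr-*S-cong []      Z≗Z′ = Z≗Z′
foldr-*S-cong (f ∷ L) Z≗Z′ = *S-congʳ f (foldr-*S-cong L Z≗Z′)

*S-identityʳ : ∀ X → (X *S oneS) ≗ X
*S-identityʳ X m = begin
    sumTo m (λ i → X i * oneS (m ℕ.∸ i)) + X m * oneS (m ℕ.∸ m)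
  ≡⟨ cong₂ _+_ (sumTo-zero m vanish) (cong (λ d → X m * oneS d) (ℕP.n∸n≡0 m)) ⟩
    + 0 + X m * + 1
  ≡⟨ trans (ℤP.+-identityˡ _) (ℤP.*-identityʳ (X m)) ⟩
    X m ∎
  where
  open ≡-Reasoning
  oneS-∸ : ∀ {i m} → i ℕ.< m → oneS (m ℕ.∸ i) ≡ + 0
  oneS-∸ {zero}  {suc m} _         = refl
  oneS-∸ {suc i} {suc m} (s≤s i<m) = oneS-∸ i<m
  vanish : ∀ i → i ℕ.< m → X i * oneS (m ℕ.∸ i) ≡ + 0
  vanish i i<m = trans (cong (_*_ (X i)) (oneS-∸ i<m)) (ℤP.*-zeroʳ (X i))

constS-*S : ∀ c Y → (constS c *S Y) ≗ scaleS c Y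
constS-*S c Y m =
  trans (sumTo-suc m _) (trans (cong (_+_ (c * Y m)) (sumTo-zero m (λ _ _ → refl))) (ℤP.+-identityʳ _))

1+n≰ᵇn : ∀ n → (suc n ℕ.≤ᵇ n) ≡ false
1+n≰ᵇn zero    = refl
1+n≰ᵇn (suc n) = 1+n≰ᵇn n

invUpTo-onePlusT : ∀ c n i → i ℕ.≤ n → invUpTo (onePlusT c) n i ≡ (- c) ^ i
invUpTo-onePlusT c zero    zero _     = refl
invUpTo-onePlusT c (suc n) i    i≤1+n with ℕP.m≤n⇒m<n∨m≡n i≤1+n
... | inj₁ (s≤s i≤n) rewrite Equivalence.to T-≡ (ℕP.≤⇒≤ᵇ i≤n) = invUpTo-onePlusT c n i i≤n
... | inj₂ refl      rewrite 1+n≰ᵇn n = begin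
    - sumTo (suc n) (λ j → onePlusT c (suc j) * invUpTo (onePlusT c) n (n ℕ.∸ j))
  ≡⟨ cong -_ (sumTo-suc n _) ⟩
    - (c * invUpTo (onePlusT c) n n + sumTo n (λ j → + 0))
  ≡⟨ cong₂ (λ x y → - (c * x + y)) (invUpTo-onePlusT c n n ℕP.≤-refl) (sumTo-zero n (λ _ _ → refl)) ⟩
    - (c * (- c) ^ n + + 0)
  ≡⟨ neg-distrib c ((- c) ^ n) ⟩
    (- c) ^ suc n ∎
  where
  open ≡-Reasoning
  neg-distrib : ∀ c p → - (c * p + + 0) ≡ - c * p
  neg-distrib = solve-∀

factorS-coeff : ∀ i m → factorS i m ≡ coefA i * (- coefA i) ^ m
factorS-coeff i m =
  trans (constS-*S (coefA i) (invS (onePlusT (coefA i))) m) (cong (_*_ (coefA i)) (invUpTo-onePlusT (coefA i) m m ℕP.≤-refl))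

mulOnePlusT-factorS : ∀ i → mulOnePlusT (coefA i) (factorS i) ≗ scaleS (coefA i) oneS
mulOnePlusT-factorS i zero    =
  trans (cong (λ x → x + a * + 0) (factorS-coeff i 0)) (constant a)
  where
  a : ℤ
  a = coefA i
  constant : ∀ a → a * + 1 + a * + 0 ≡ a * + 1
  constant = solve-∀
mulOnePlusT-factorS i (suc m) =
  trans (cong₂ (λ x y → x + a * y) (factorS-coeff i (suc m)) (factorS-coeff i m)) (cancel a _)
  where
  a : ℤ
  a = coefA i
  cancel : ∀ a p → a * (- a * p) + a * (a * p) ≡ a * + 0
  cancel = solve-∀

prodFactors : ℕ → FPS
prodFactors c = prodS (map factorS (upTo c))

prodFactors-suc : ∀ c → prodFactors (suc c) ≡ foldr _*S_ (factorS c *S oneS) (map factorS (upTo c))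
prodFactors-suc c = begin
    foldr _*S_ oneS (map factorS (upTo (suc c)))
  ≡⟨ cong (foldr _*S_ oneS ∘ map factorS) (sym (LP.upTo-∷ʳ c)) ⟩
    foldr _*S_ oneS (map factorS (upTo c ++ c ∷ []))
  ≡⟨ cong (foldr _*S_ oneS) (LP.map-++ factorS (upTo c) (c ∷ [])) ⟩
    foldr _*S_ oneS (map factorS (upTo c) ++ factorS c ∷ [])
  ≡⟨ LP.foldr-++ _*S_ oneS (map factorS (upTo c)) (factorS c ∷ []) ⟩
    foldr _*S_ (factorS c *S oneS) (map factorS (upTo c)) ∎
  where open ≡-Reasoning

mulOnePlusT-prodFactors : ∀ c → mulOnePlusT (coefA c) (prodFactors (suc c)) ≗ scaleS (coefA c) (prodFactors c)
mulOnePlusT-prodFactors c m = begin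
    mulOnePlusT a (prodFactors (suc c)) m
  ≡⟨ cong (λ F → mulOnePlusT a F m) (prodFactors-suc c) ⟩
    mulOnePlusT a (foldr _*S_ (factorS c *S oneS) L) m
  ≡⟨ sym (foldr-*S-comm (mulOnePlusT a) (mulOnePlusT-cong a) (*S-mulOnePlusT a) L _ m) ⟩
    foldr _*S_ (mulOnePlusT a (factorS c *S oneS)) L m
  ≡⟨ foldr-*S-cong L (λ n → trans (mulOnePlusT-cong a (*S-identityʳ (factorS c)) n) (mulOnePlusT-factorS c n)) m ⟩
    foldr _*S_ (scaleS a oneS) L m
  ≡⟨ foldr-*S-comm (scaleS a) (λ X≗Y n → cong (_*_ a) (X≗Y n)) (λ f X → *S-scaleS f a X) L oneS m ⟩
    scaleS a (prodFactors c) m ∎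
  where
  open ≡-Reasoning
  a : ℤ
  a = coefA c
  L : List FPS
  L = map factorS (upTo c)

shiftedProduct : ℕ → FPS
shiftedProduct c = shiftS c (prodFactors c)

shiftedProduct-suc : ∀ c k → shiftedProduct (suc c) (suc k) + coefA c * shiftedProduct (suc c) k
                           ≡ coefA c * shiftedProduct c k
shiftedProduct-suc c k = begin
    shiftS c P k + a * shiftS (suc c) P k
  ≡⟨ cong (λ y → shiftS c P k + a * y) (shiftS-suc c P k) ⟩
    mulOnePlusT a (shiftS c P) k
  ≡⟨ sym (shiftS-mulOnePlusT c a P k) ⟩
    shiftS c (mulOnePlusT a P) k
  ≡⟨ shiftS-cong c (mulOnePlusT-prodFactors c) k ⟩
    shiftS c (scaleS a (prodFactors c)) k
  ≡⟨ shiftS-scaleS c a (prodFactors c) k ⟩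
    a * shiftedProduct c k ∎
  where
  open ≡-Reasoning
  a : ℤ
  a = coefA c
  P : FPS
  P = prodFactors (suc c)

-- Counting primitive Fishburn matrices

bools : List Bool
bools = true ∷ false ∷ []

boolVecs : (k : ℕ) → List (Vec Bool k)
boolVecs = allVecs bools

sgn : Bool → ℤ
sgn b = if b then - + 1 else + 1

-- A set S of columns is encoded by the vector with lookup S j = true iff j ∈ S.
sign : ∀ {k} → Vec Bool k → ℤ
sign {k} S = ∏[ j < k ] sgn (lookup S j)

∏-complement≡∑-subsets : ∀ {k} (Z : Fin k → ℤ) →
  ∏[ j < k ] (+ 1 - Z j) ≡ ∑[ S ∈ boolVecs k ] ∏[ j < k ] (if lookup S j then - Z j else + 1)
∏-complement≡∑-subsets {k} Z =
  trans (∏-cong (λ j → ℤP.+-comm (+ 1) (- Z j)))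
        (sym (∑-allVecs-∏ bools k (λ j s → if s then - Z j else + 1)))

does-≟-true : ∀ b → does (b ≟ᵇ true) ≡ b
does-≟-true true  = refl
does-≟-true false = refl

does-≟-false : ∀ b → does (b ≟ᵇ false) ≡ not b
does-≟-false true  = refl
does-≟-false false = refl

ι-all?-any? : ∀ {m n} (b : Fin m → Fin n → Bool) →
              ι (does (all? (λ x → any? (λ y → b x y ≟ᵇ true))))
              ≡ ∏[ x < m ] (+ 1 - ∏[ y < n ] ι (not (b x y)))
ι-all?-any? b =
  trans (ι-all? (λ x → any? (λ y → b x y ≟ᵇ true))) (∏-cong λ x → trans (ι-any? (λ y → b x y ≟ᵇ true))
    (cong (λ z → + 1 - z) (∏-cong λ y → cong (ι ∘ not) (does-≟-true (b x y)))))

ι-∨-not-∧ : ∀ a b x → ι (a ∨ not x) * ι (b ∨ not x) ≡ ι (not x ∨ (a ∧ b))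
ι-∨-not-∧ true  true  true  = refl
ι-∨-not-∧ true  true  false = refl
ι-∨-not-∧ true  false true  = refl
ι-∨-not-∧ true  false false = refl
ι-∨-not-∧ false true  true  = refl
ι-∨-not-∧ false true  false = refl
ι-∨-not-∧ false false true  = refl
ι-∨-not-∧ false false false = refl

isOpen : ∀ {k} → Fin k → Vec Bool k → Fin k → Bool
isOpen i S j = not (does (j <? i)) ∧ not (lookup S j)

nonzeroWithin : ∀ {k} → (Fin k → Bool) → Vec Bool k → ℤ
nonzeroWithin {k} o r = ∏[ j < k ] ι (not (lookup r j) ∨ o j) * (+ 1 - ∏[ j < k ] ι (not (lookup r j)))

module _ {k} (M : BMatrix k) where

  private
    e : Fin k → Fin k → Bool
    e = entry M

    upperTriangular? : Dec (UpperTriangular M)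
    upperTriangular? = all? (λ i → all? (λ j → (j <? i) →-dec (e i j ≟ᵇ false)))
    rowsNonzero? : Dec (RowsNonzero M)
    rowsNonzero? = all? (λ i → any? (λ j → e i j ≟ᵇ true))
    colsNonzero? : Dec (ColsNonzero M)
    colsNonzero? = all? (λ j → any? (λ i → e i j ≟ᵇ true))

    lower : Fin k → Fin k → ℤ
    lower i j = ι (not (does (j <? i)) ∨ not (e i j))
    excluded : Vec Bool k → Fin k → Fin k → ℤ
    excluded S i j = ι (not (lookup S j) ∨ not (e i j))
    N Z : Fin k → ℤ
    N i = ∏[ j < k ] ι (not (e i j))
    Z j = ∏[ i < k ] ι (not (e i j))
    U R : ℤ
    U = ∏[ i < k ] ∏[ j < k ] lower i j
    R = ∏[ i < k ] (+ 1 - N i)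
    C : Vec Bool k → ℤ
    C S = ∏[ i < k ] ∏[ j < k ] excluded S i j

    ι-upperTriangular? : ι (does upperTriangular?) ≡ U
    ι-upperTriangular? =
      trans (ι-all? (λ i → all? (λ j → (j <? i) →-dec (e i j ≟ᵇ false)))) (∏-cong λ i →
        trans (ι-all? (λ j → (j <? i) →-dec (e i j ≟ᵇ false))) (∏-cong λ j →
          cong (λ b → ι (not (does (j <? i)) ∨ b)) (does-≟-false (e i j))))

    column : ∀ S j → (if lookup S j then - Z j else + 1) ≡ sgn (lookup S j) * ∏[ i < k ] excluded S i j
    column S j with lookup S j
    ... | true  = sym (ℤP.-1*i≡-i (Z j))
    ... | false = sym (trans (ℤP.*-identityˡ _) (∏-one k))

    ι-colsNonzero? : ι (does colsNonzero?) ≡ ∑[ S ∈ boolVecs k ] (sign S * C S)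
    ι-colsNonzero? = begin
        ι (does colsNonzero?)
      ≡⟨ ι-all?-any? (λ j i → e i j) ⟩
        ∏[ j < k ] (+ 1 - Z j)
      ≡⟨ ∏-complement≡∑-subsets Z ⟩
        ∑[ S ∈ boolVecs k ] ∏[ j < k ] (if lookup S j then - Z j else + 1)
      ≡⟨ ∑-cong (boolVecs k) (λ S → trans (∏-cong (column S))
           (trans (∏-distrib-* (sgn ∘ lookup S) (λ j → ∏[ i < k ] excluded S i j))
                  (cong (_*_ (sign S)) (∏-comm (λ j i → excluded S i j))))) ⟩
        ∑[ S ∈ boolVecs k ] (sign S * C S) ∎
      where open ≡-Reasoning

    row : ∀ S i → ∏[ j < k ] lower i j * ∏[ j < k ] excluded S i j ≡ ∏[ j < k ] ι (not (e i j) ∨ isOpen i S j)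
    row S i = trans (sym (∏-distrib-* (lower i) (excluded S i)))
                    (∏-cong λ j → ι-∨-not-∧ (not (does (j <? i))) (not (lookup S j)) (e i j))

    rows : ∀ S → U * R * C S ≡ ∏[ i < k ] nonzeroWithin (isOpen i S) (lookup M i)
    rows S = begin
        U * R * C S
      ≡⟨ cong (_* C S) (sym (∏-distrib-* (λ i → ∏[ j < k ] lower i j) (λ i → + 1 - N i))) ⟩
        ∏[ i < k ] (∏[ j < k ] lower i j * (+ 1 - N i)) * C S
      ≡⟨ sym (∏-distrib-* (λ i → ∏[ j < k ] lower i j * (+ 1 - N i)) (λ i → ∏[ j < k ] excluded S i j)) ⟩
        ∏[ i < k ] (∏[ j < k ] lower i j * (+ 1 - N i) * ∏[ j < k ] excluded S i j)
      ≡⟨ ∏-cong (λ i → trans (*-right-comm (∏[ j < k ] lower i j) (+ 1 - N i) (∏[ j < k ] excluded S i j))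
                             (cong (_* (+ 1 - N i)) (row S i))) ⟩
        ∏[ i < k ] nonzeroWithin (isOpen i S) (lookup M i) ∎
      where open ≡-Reasoning

  ι-primitiveFishburn? : ι (does (primitiveFishburn? M))
                       ≡ ∑[ S ∈ boolVecs k ] (sign S * ∏[ i < k ] nonzeroWithin (isOpen i S) (lookup M i))
  ι-primitiveFishburn? = begin
      ι (does (upperTriangular? ×-dec rowsNonzero? ×-dec colsNonzero?))
    ≡⟨ ι-∧ (does upperTriangular?) _ ⟩
      ι (does upperTriangular?) * ι (does (rowsNonzero? ×-dec colsNonzero?))
    ≡⟨ cong₂ _*_ ι-upperTriangular? (ι-∧ (does rowsNonzero?) (does colsNonzero?)) ⟩
      U * (ι (does rowsNonzero?) * ι (does colsNonzero?))
    ≡⟨ cong (_*_ U) (cong₂ _*_ (ι-all?-any? e) ι-colsNonzero?) ⟩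
      U * (R * ∑[ S ∈ boolVecs k ] (sign S * C S))
    ≡⟨ sym (ℤP.*-assoc U R _) ⟩
      U * R * ∑[ S ∈ boolVecs k ] (sign S * C S)
    ≡⟨ *-distribˡ-∑ (U * R) (boolVecs k) _ ⟩
      ∑[ S ∈ boolVecs k ] (U * R * (sign S * C S))
    ≡⟨ ∑-cong (boolVecs k) (λ S → trans (*-left-comm (U * R) (sign S) (C S)) (cong (_*_ (sign S)) (rows S))) ⟩
      ∑[ S ∈ boolVecs k ] (sign S * ∏[ i < k ] nonzeroWithin (isOpen i S) (lookup M i)) ∎
    where open ≡-Reasoning

∑-nonzeroWithin : ∀ {k} (o : Fin k → Bool) →
                  ∑[ r ∈ boolVecs k ] nonzeroWithin o r ≡ ∏[ j < k ] (ι (o j) + + 1) - + 1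
∑-nonzeroWithin {k} o = begin
    ∑[ r ∈ boolVecs k ] nonzeroWithin o r
  ≡⟨ x≡[x+y]-y _ _ ⟩
    ∑[ r ∈ boolVecs k ] nonzeroWithin o r + ∑[ r ∈ boolVecs k ] isZero r - ∑[ r ∈ boolVecs k ] isZero r
  ≡⟨ cong₂ _-_ (trans (sym (∑-distrib-+ (boolVecs k) _ isZero)) (∑-cong (boolVecs k) split)) ∑isZero≡1 ⟩
    ∑[ r ∈ boolVecs k ] supported r - + 1
  ≡⟨ cong (_- + 1) (∑-allVecs-∏ bools k a) ⟩
    ∏[ j < k ] (ι (o j) + + 1) - + 1 ∎
  where
  open ≡-Reasoning
  a : Fin k → Bool → ℤ
  a j x = ι (not x ∨ o j)
  supported isZero : Vec Bool k → ℤ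
  supported r = ∏[ j < k ] a j (lookup r j)
  isZero r = ∏[ j < k ] (a j (lookup r j) * ι (not (lookup r j)))
  x≡[x+y]-y : ∀ x y → x ≡ x + y - y
  x≡[x+y]-y = solve-∀
  complement : ∀ x y → x * (+ 1 - y) + x * y ≡ x
  complement = solve-∀
  split : ∀ r → nonzeroWithin o r + isZero r ≡ supported r
  split r = trans (cong (_+_ (nonzeroWithin o r)) (∏-distrib-* (λ j → a j (lookup r j)) (ι ∘ not ∘ lookup r)))
                  (complement (supported r) _)
  zero-only : ∀ j → ∑[ x ∈ bools ] (a j x * ι (not x)) ≡ + 1
  zero-only j with o j
  ... | true  = refl
  ... | false = refl
  ∑isZero≡1 : ∑[ r ∈ boolVecs k ] isZero r ≡ + 1
  ∑isZero≡1 = trans (∑-allVecs-∏ bools k (λ j x → a j x * ι (not x)))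
                    (trans (∏-cong zero-only) (∏-one k))

freeCount : ∀ {k} → Vec Bool k → ℕ
freeCount []          = 0
freeCount (true ∷ S)  = freeCount S
freeCount (false ∷ S) = suc (freeCount S)

freeCount-≤ : ∀ {k} (S : Vec Bool k) → freeCount S ℕ.≤ k
freeCount-≤ []          = z≤n
freeCount-≤ (true ∷ S)  = ℕP.m≤n⇒m≤1+n (freeCount-≤ S)
freeCount-≤ (false ∷ S) = s≤s (freeCount-≤ S)

mersenne : ℕ → ℤ
mersenne n = + (2 ℕ.^ n) - + 1

weight : ∀ {k} → Vec Bool k → ℤ
weight []      = + 1
weight (s ∷ S) = sgn s * mersenne (freeCount (s ∷ S)) * weight S

∏-free : ∀ {k} (S : Vec Bool k) → ∏[ j < k ] (ι (not (lookup S j)) + + 1) ≡ + (2 ℕ.^ freeCount S)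
∏-free []          = refl
∏-free (true ∷ S)  = trans (ℤP.*-identityˡ _) (∏-free S)
∏-free (false ∷ S) = trans (cong (_*_ (+ 2)) (∏-free S)) (sym (ℤP.pos-* 2 (2 ℕ.^ freeCount S)))

sign-∏-isOpen : ∀ {k} (S : Vec Bool k) →
                sign S * ∏[ i < k ] (∏[ j < k ] (ι (isOpen i S j) + + 1) - + 1) ≡ weight S
sign-∏-isOpen []      = refl
sign-∏-isOpen {suc k} (s ∷ S) = begin
    sgn s * sign S * ((∏[ j < suc k ] (ι (isOpen zero (s ∷ S) j) + + 1) - + 1) * rest)
  ≡⟨ cong₂ (λ p q → sgn s * sign S * ((p - + 1) * q)) (∏-free (s ∷ S))
           (∏-cong {k} λ i → cong (_- + 1) (ℤP.*-identityˡ (∏[ j < k ] (ι (isOpen i S j) + + 1)))) ⟩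
    sgn s * sign S * (mersenne (freeCount (s ∷ S)) * ∏[ i < k ] (∏[ j < k ] (ι (isOpen i S j) + + 1) - + 1))
  ≡⟨ *-interchange (sgn s) (sign S) _ _ ⟩
    sgn s * mersenne (freeCount (s ∷ S)) * (sign S * ∏[ i < k ] (∏[ j < k ] (ι (isOpen i S j) + + 1) - + 1))
  ≡⟨ cong (_*_ (sgn s * mersenne (freeCount (s ∷ S)))) (sign-∏-isOpen S) ⟩
    weight (s ∷ S) ∎
  where
  open ≡-Reasoning
  rest : ℤ
  rest = ∏[ i < k ] (∏[ j < suc k ] (ι (isOpen (suc i) (s ∷ S) j) + + 1) - + 1)

+numPrimFishburn≡∑weight : ∀ k → + numPrimFishburn k ≡ ∑[ S ∈ boolVecs k ] weight S
+numPrimFishburn≡∑weight k = begin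
    + numPrimFishburn k
  ≡⟨ +length-filter primitiveFishburn? (allBMatrices k) ⟩
    ∑[ M ∈ allBMatrices k ] ι (does (primitiveFishburn? M))
  ≡⟨ ∑-cong (allBMatrices k) ι-primitiveFishburn? ⟩
    ∑[ M ∈ allBMatrices k ] ∑[ S ∈ boolVecs k ] (sign S * ∏[ i < k ] nonzeroWithin (isOpen i S) (lookup M i))
  ≡⟨ ∑-comm (allBMatrices k) (boolVecs k) _ ⟩
    ∑[ S ∈ boolVecs k ] ∑[ M ∈ allBMatrices k ] (sign S * ∏[ i < k ] nonzeroWithin (isOpen i S) (lookup M i))
  ≡⟨ ∑-cong (boolVecs k) (λ S → sym (*-distribˡ-∑ (sign S) (allBMatrices k) _)) ⟩
    ∑[ S ∈ boolVecs k ] (sign S * ∑[ M ∈ allBMatrices k ] ∏[ i < k ] nonzeroWithin (isOpen i S) (lookup M i))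
  ≡⟨ ∑-cong (boolVecs k) (λ S → cong (_*_ (sign S))
       (trans (∑-allVecs-∏ (boolVecs k) k (λ i → nonzeroWithin (isOpen i S)))
              (∏-cong λ i → ∑-nonzeroWithin (isOpen i S)))) ⟩
    ∑[ S ∈ boolVecs k ] (sign S * ∏[ i < k ] (∏[ j < k ] (ι (isOpen i S j) + + 1) - + 1))
  ≡⟨ ∑-cong (boolVecs k) sign-∏-isOpen ⟩
    ∑[ S ∈ boolVecs k ] weight S ∎
  where open ≡-Reasoning

-- Grouping by the number of free columns

δ : ℕ → ℕ → ℤ
δ m c = if m ≡ᵇ c then + 1 else + 0

δ-≢ : ∀ {m c} → m ≢ c → δ m c ≡ + 0
δ-≢ {m} {c} m≢c with m ≡ᵇ c in m≡ᵇc
... | true  = contradiction (ℕP.≡ᵇ⇒≡ m c (subst T (sym m≡ᵇc) tt)) m≢c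
... | false = refl

δ-subst : ∀ m c (f : ℕ → ℤ) → f m * δ m c ≡ f c * δ m c
δ-subst m c f with m ℕ.≟ c
... | yes refl = refl
... | no  m≢c  rewrite δ-≢ m≢c = trans (ℤP.*-zeroʳ (f m)) (sym (ℤP.*-zeroʳ (f c)))

δ-refl : ∀ m → δ m m ≡ + 1
δ-refl zero    = refl
δ-refl (suc m) = δ-refl m

sumTo-δ : ∀ N m → m ℕ.< N → sumTo N (δ m) ≡ + 1
sumTo-δ (suc N) m (s≤s m≤N) with ℕP.m≤n⇒m<n∨m≡n m≤N
... | inj₁ m<N  = cong₂ _+_ (sumTo-δ N m m<N) (δ-≢ (ℕP.<⇒≢ m<N))
... | inj₂ refl = cong₂ _+_ (sumTo-zero m (λ c c<m → δ-≢ (ℕP.>⇒≢ c<m))) (δ-refl m)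

fiberWeight : ℕ → ℕ → ℤ
fiberWeight k c = ∑[ S ∈ boolVecs k ] (weight S * δ (freeCount S) c)

fiberWeight≡shiftedProduct : ∀ k c → fiberWeight k c ≡ shiftedProduct c k
fiberWeight≡shiftedProduct zero    zero    = refl
fiberWeight≡shiftedProduct zero    (suc c) = refl
fiberWeight≡shiftedProduct (suc k) zero    =
  trans (∑-allVecs-suc bools k _) (trans (∑-cong (boolVecs k) vanish) (∑-zero (boolVecs k)))
  where
  absorb : ∀ x → + 0 + (x * + 0 + + 0) ≡ + 0
  absorb = solve-∀
  vanish : ∀ S → weight (true ∷ S) * δ (freeCount S) 0 + (weight (false ∷ S) * δ (suc (freeCount S)) 0 + + 0) ≡ + 0
  vanish S = trans (cong (_+ (weight (false ∷ S) * + 0 + + 0)) (δ-subst (freeCount S) 0 (λ x → sgn true * mersenne x * weight S)))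
                   (absorb (weight (false ∷ S)))
fiberWeight≡shiftedProduct (suc k) (suc c) = begin
    fiberWeight (suc k) (suc c)
  ≡⟨ ∑-allVecs-suc bools k _ ⟩
    ∑[ S ∈ boolVecs k ] (weight (true ∷ S) * δ (freeCount S) (suc c) + (weight (false ∷ S) * δ (freeCount S) c + + 0))
  ≡⟨ ∑-cong (boolVecs k) step ⟩
    ∑[ S ∈ boolVecs k ] (- a * (weight S * δ (freeCount S) (suc c)) + a * (weight S * δ (freeCount S) c))
  ≡⟨ ∑-distrib-+ (boolVecs k) _ _ ⟩
    ∑[ S ∈ boolVecs k ] (- a * (weight S * δ (freeCount S) (suc c))) + ∑[ S ∈ boolVecs k ] (a * (weight S * δ (freeCount S) c))
  ≡⟨ sym (cong₂ _+_ (*-distribˡ-∑ (- a) (boolVecs k) _) (*-distribˡ-∑ a (boolVecs k) _)) ⟩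
    - a * fiberWeight k (suc c) + a * fiberWeight k c
  ≡⟨ cong₂ (λ x y → - a * x + a * y) (fiberWeight≡shiftedProduct k (suc c)) (fiberWeight≡shiftedProduct k c) ⟩
    - a * shiftedProduct (suc c) k + a * shiftedProduct c k
  ≡⟨ cong (_+_ (- a * shiftedProduct (suc c) k)) (sym (shiftedProduct-suc c k)) ⟩
    - a * shiftedProduct (suc c) k + (shiftedProduct (suc c) (suc k) + a * shiftedProduct (suc c) k)
  ≡⟨ cancel a _ _ ⟩
    shiftedProduct (suc c) (suc k) ∎
  where
  open ≡-Reasoning
  a : ℤ
  a = coefA c
  signs : ∀ a w d d′ → - + 1 * a * w * d + (+ 1 * a * w * d′ + + 0) ≡ - a * (w * d) + a * (w * d′)
  signs = solve-∀
  cancel : ∀ a y x → - a * y + (x + a * y) ≡ x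
  cancel = solve-∀
  step : ∀ S → weight (true ∷ S) * δ (freeCount S) (suc c) + (weight (false ∷ S) * δ (freeCount S) c + + 0)
             ≡ - a * (weight S * δ (freeCount S) (suc c)) + a * (weight S * δ (freeCount S) c)
  step S = trans (cong₂ (λ x y → x + (y + + 0))
                        (δ-subst (freeCount S) (suc c) (λ x → sgn true * mersenne x * weight S))
                        (δ-subst (freeCount S) c (λ x → sgn false * mersenne (suc x) * weight S)))
                 (signs a (weight S) _ _)

∑weight≡sumTo-shiftedProduct : ∀ k N → k ℕ.< N → ∑[ S ∈ boolVecs k ] weight S ≡ sumTo N (λ c → shiftedProduct c k)
∑weight≡sumTo-shiftedProduct k N k<N = begin
    ∑[ S ∈ boolVecs k ] weight S
  ≡⟨ ∑-cong (boolVecs k) spread ⟩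
    ∑[ S ∈ boolVecs k ] sumTo N (λ c → weight S * δ (freeCount S) c)
  ≡⟨ ∑-sumTo-comm (boolVecs k) N _ ⟩
    sumTo N (fiberWeight k)
  ≡⟨ sumTo-cong N (λ c _ → fiberWeight≡shiftedProduct k c) ⟩
    sumTo N (λ c → shiftedProduct c k) ∎
  where
  open ≡-Reasoning
  spread : ∀ S → weight S ≡ sumTo N (λ c → weight S * δ (freeCount S) c)
  spread S = begin
      weight S
    ≡⟨ sym (ℤP.*-identityʳ (weight S)) ⟩
      weight S * + 1
    ≡⟨ cong (_*_ (weight S)) (sym (sumTo-δ N (freeCount S) (ℕP.≤-<-trans (freeCount-≤ S) k<N))) ⟩
      weight S * sumTo N (δ (freeCount S))
    ≡⟨ *-distribˡ-sumTo N (weight S) _ ⟩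
      sumTo N (λ c → weight S * δ (freeCount S) c) ∎

corollary4 : (k : ℕ) → lhsS k ≡ rhsS k
corollary4 zero    = refl
corollary4 (suc k) = begin
    + numPrimFishburn (suc k)
  ≡⟨ +numPrimFishburn≡∑weight (suc k) ⟩
    ∑[ S ∈ boolVecs (suc k) ] weight S
  ≡⟨ ∑weight≡sumTo-shiftedProduct (suc k) (3 ℕ.+ k) (ℕP.m<n⇒m<1+n (ℕP.n<1+n (suc k))) ⟩
    sumTo (3 ℕ.+ k) (λ c → shiftedProduct c (suc k))
  ≡⟨ sumTo-suc (2 ℕ.+ k) _ ⟩
    + 0 + rhsS (suc k)
  ≡⟨ ℤP.+-identityˡ _ ⟩
    rhsS (suc k) ∎
  where open ≡-Reasoning
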